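{- For every integer $k\ge 19$ and $n=6k$, there is no weakly-balanced sequence of $n$ permutations of $[n]$; that is, there are no bijections $\sigma_1,\ldots,\sigma_n$ from a set $N$ of $n$ players to $[n]$ such that $Z_i^t[j]\le\lfloor jn/t+1\rfloor$ for all $t\in[n]$, $j\in[t]$ and $i\in N$.
   Context: There are $n$ players $N$ and $n$ items $[n]=\{1,\ldots,n\}$, item $1$ being the best. $\sigma_s$ is the assignment on day $s$. The bundle of player $i$ after day $t$ is the multiset $Z_i^t=\{\sigma_1(i),\ldots,\sigma_t(i)\}$. For a multiset $Z$ and $k\le|Z|$, $Z[k]$ is the $k$-th smallest number in $Z$ (counted with multiplicity). -}

module Defs where

open import Data.Nat using (ℕ; zero; suc; _+_; _*_; _/_; _≤_; _<_)
open import Data.Nat.Properties using (≤-decTotalOrder)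
open import Data.Fin using (Fin; toℕ)
open import Data.List using (List; []; _∷_; length; map; lookup; _∷ʳ_)
open import Data.List.Sort.InsertionSort ≤-decTotalOrder using (sort)
open import Function.Definitions using (Bijective)
open import Relation.Binary.PropositionalEquality using (_≡_)

-- Players N = Fin n; items [n] = {1,..,n} represented by Fin n,
-- the item x : Fin n having number (toℕ x + 1)  (so item 1 = best = Fin.zero).
item : {n : ℕ} → Fin n → ℕ
item x = suc (toℕ x)

-- An assignment sequence: σ s is the assignment on day s (days s = 1,..,n are used).
Schedule : ℕ → Set
Schedule n = ℕ → Fin n → Fin n

bundle : {n : ℕ} → Schedule n → Fin n → ℕ → List ℕ
bundle σ i zero    = []
bundle σ i (suc t) = bundle σ i t ∷ʳ item (σ (suc t) i)

-- Z[k] for 1 ≤ k ≤ |Z|: the k-th smallest element counted with multiplicity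
-- (k is given 0-based as a Fin index into the sorted list, i.e. Z[k+1]).
kth : (Z : List ℕ) → Fin (length (sort Z)) → ℕ
kth Z k = lookup (sort Z) k

AllBijections : (n : ℕ) → Schedule n → Set
AllBijections n σ = (s : ℕ) → 1 ≤ s → s ≤ n → Bijective _≡_ _≡_ (σ s)

-- Weak balance for player i after t = suc t' days:
-- Z_i^t[j] ≤ ⌊ j n / t + 1 ⌋ = ⌊ j n / t ⌋ + 1 for all j ∈ [t]
-- (j ranges over the positions of the sorted bundle, whose length is t).
WeaklyBalancedAt : (n : ℕ) → Schedule n → (t' : ℕ) → Fin n → Set
WeaklyBalancedAt n σ t' i =
  (j : Fin (length (sort (bundle σ i (suc t'))))) →
    kth (bundle σ i (suc t')) j ≤ (suc (toℕ j) * n) / suc t' + 1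

-- For a player with items x₁, x₂, x₃, x₄ on those days, weak balance
-- gives min(x₁,x₂) ≤ n/2 + 1, min(x₁,x₂,x₃) ≤ n/3 + 1, min(x₁,…,x₄) ≤ n/4 + 1, and the second
-- smallest of x₁,…,x₄ is ≤ n/2 + 1. A short case analysis turns this into the bound
--   #{s ≤ 4 : x_s ≤ n/2 + 1} + #{s ≤ 2 : x_s ≤ n/3 + 1} + [x₃ ≤ n/4 + 1]  ≥  3.
-- Since every day's assignment is a bijection, summing over the n players gives
-- 3n ≤ 4(n/2 + 1) + 2(n/3 + 1) + (n/4 + 1), i.e. n ≤ 84, which fails once k ≥ 15.
module Submission where

open import Defs
open import Data.Nat using (ℕ; zero; suc; _+_; _*_; _/_; _⊓_; _<_; _≤_; z≤n; s≤s; _≤?_; _<?_; NonZero)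
open import Data.Nat.Properties
open import Data.Nat.DivMod using (m*n/n≡m; m/n*n≤m; /-monoʳ-≤; m*n/m*o≡n/o)
open import Data.Nat.ListAction using (sum)
open import Data.Nat.ListAction.Properties using (sum-↭; sum-++)
open import Data.Nat.Tactic.RingSolver using (solve)
open import Data.Fin using (Fin; toℕ; fromℕ<)
open import Data.Fin.Properties using (toℕ-fromℕ<)
open import Data.List using (List; []; _∷_; _++_; length; map; lookup)
open import Data.List.Properties using (map-++; length-++)
open import Data.List.Relation.Unary.All as All using (All)
open import Data.List.Relation.Unary.Linked using (tail)
open import Data.List.Relation.Unary.Sorted.TotalOrder ≤-totalOrder using (Sorted)
open import Data.List.Relation.Unary.Sorted.TotalOrder.Properties using (lookup-mono-≤)
open import Data.List.Relation.Binary.Permutation.Propositional using (_↭_)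
open import Data.List.Relation.Binary.Permutation.Propositional.Properties using (↭-length; map⁺)
open import Data.List.Sort.InsertionSort ≤-decTotalOrder using (sort)
open import Data.List.Sort.InsertionSort.Properties ≤-decTotalOrder using (sort-↭; sort-↗)
open import Data.Product using (Σ; _×_; _,_)
open import Function.Bundles using (mk⤖)
open import Function.Definitions using (Bijective)
open import Function.Properties.Bijection using (⤖⇒↔)
open import Algebra.Properties.CommutativeMonoid.Sum +-0-commutativeMonoid
  using (sum-permute; ∑-distrib-+; sum-replicate-zero; sum-syntax)
open import Relation.Nullary using (¬_; yes; no; contradiction)
open import Relation.Nullary.Decidable using (True; toWitness; from-yes)
open import Relation.Binary.PropositionalEquality
  using (_≡_; refl; sym; trans; cong; cong₂; subst; subst₂; module ≡-Reasoning)

𝟙[_≤_] : ℕ → ℕ → ℕ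
𝟙[ zero  ≤ b     ] = 1
𝟙[ suc x ≤ zero  ] = 0
𝟙[ suc x ≤ suc b ] = 𝟙[ x ≤ b ]

𝟙-≤ : ∀ {x b} → x ≤ b → 𝟙[ x ≤ b ] ≡ 1
𝟙-≤ z≤n       = refl
𝟙-≤ (s≤s x≤b) = 𝟙-≤ x≤b

𝟙-> : ∀ {x b} → b < x → 𝟙[ x ≤ b ] ≡ 0
𝟙-> {b = zero}  (s≤s _)   = refl
𝟙-> {b = suc b} (s≤s b<x) = 𝟙-> b<x

count≤ : ℕ → List ℕ → ℕ
count≤ b xs = sum (map (λ x → 𝟙[ x ≤ b ]) xs)

count≤-↭ : ∀ {b xs ys} → xs ↭ ys → count≤ b xs ≡ count≤ b ys
count≤-↭ p = sum-↭ (map⁺ _ p)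

count≤-++ : ∀ b xs ys → count≤ b (xs ++ ys) ≡ count≤ b xs + count≤ b ys
count≤-++ b xs ys = trans (cong sum (map-++ _ xs ys)) (sum-++ (map _ xs) _)

count≤-∷-≤ : ∀ {x b} xs → x ≤ b → count≤ b (x ∷ xs) ≡ suc (count≤ b xs)
count≤-∷-≤ xs x≤b = cong (_+ _) (𝟙-≤ x≤b)

count≤-∷-> : ∀ {x b} xs → b < x → count≤ b (x ∷ xs) ≡ count≤ b xs
count≤-∷-> xs b<x = cong (_+ _) (𝟙-> b<x)

1≤count≤-∷ : ∀ {x b} xs → x ≤ b → 1 ≤ count≤ b (x ∷ xs)
1≤count≤-∷ xs x≤b = subst (1 ≤_) (sym (count≤-∷-≤ xs x≤b)) (s≤s z≤n)

1≤count≤-[_]⇒≤ : ∀ x {b} → 1 ≤ count≤ b (x ∷ []) → x ≤ b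
1≤count≤-[ x ]⇒≤ {b} h with x ≤? b
... | yes x≤b = x≤b
... | no  x≰b = contradiction (subst (1 ≤_) (count≤-∷-> [] (≰⇒> x≰b)) h) λ ()

count≤-sorted : ∀ {b ys} → Sorted ys → (j : Fin (length ys)) → lookup ys j ≤ b →
  suc (toℕ j) ≤ count≤ b ys
count≤-sorted {b} {y ∷ ys} _ Fin.zero    y≤b  = 1≤count≤-∷ ys y≤b
count≤-sorted {b} {y ∷ ys} ↗ (Fin.suc j) yⱼ≤b =
  subst (suc (suc (toℕ j)) ≤_) (sym (count≤-∷-≤ ys y≤b)) (s≤s (count≤-sorted (tail ↗) j yⱼ≤b))
  where
  y≤b : y ≤ b
  y≤b = ≤-trans (lookup-mono-≤ ≤-totalOrder ↗ {Fin.zero} {Fin.suc j} z≤n) yⱼ≤b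

kth≤⇒count≤ : ∀ {b} Z (j : Fin (length (sort Z))) → kth Z j ≤ b → suc (toℕ j) ≤ count≤ b Z
kth≤⇒count≤ Z j Zⱼ≤b = subst (suc (toℕ j) ≤_) (count≤-↭ (sort-↭ Z)) (count≤-sorted (sort-↗ Z) j Zⱼ≤b)

length-bundle : ∀ {n} (σ : Schedule n) i t → length (bundle σ i t) ≡ t
length-bundle σ i zero    = refl
length-bundle σ i (suc t) =
  trans (length-++ (bundle σ i t)) (trans (cong (_+ 1) (length-bundle σ i t)) (+-comm t 1))

weaklyBalanced⇒count≤ : ∀ {n σ t' i m} → WeaklyBalancedAt n σ t' i → m ≤ t' →
  suc m ≤ count≤ ((suc m * n) / suc t' + 1) (bundle σ i (suc t'))
weaklyBalanced⇒count≤ {n} {σ} {t'} {i} {m} balanced m≤t' =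
  subst (λ m → suc m ≤ count≤ ((suc m * n) / suc t' + 1) Z) (toℕ-fromℕ< m<len)
        (kth≤⇒count≤ Z j (balanced j))
  where
  Z = bundle σ i (suc t')
  m<len : m < length (sort Z)
  m<len = subst (m <_) (sym (trans (↭-length (sort-↭ Z)) (length-bundle σ i (suc t')))) (s≤s m≤t')
  j = fromℕ< m<len

∑-∘-bijective : ∀ {n} (g : Fin n → ℕ) {f : Fin n → Fin n} → Bijective _≡_ _≡_ f →
  ∑[ i < n ] g (f i) ≡ ∑[ i < n ] g i
∑-∘-bijective g f-bij = sym (sum-permute g (⤖⇒↔ (mk⤖ f-bij)))

∑-𝟙[item≤] : ∀ n b → ∑[ i < n ] 𝟙[ item i ≤ b ] ≡ n ⊓ b
∑-𝟙[item≤] zero    b       = refl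
∑-𝟙[item≤] (suc n) zero    = sum-replicate-zero (suc n)
∑-𝟙[item≤] (suc n) (suc b) = cong suc (∑-𝟙[item≤] n b)

n*c≤∑ : ∀ {n} c (f : Fin n → ℕ) → (∀ i → c ≤ f i) → n * c ≤ ∑[ i < n ] f i
n*c≤∑ {zero}  c f c≤f = z≤n
n*c≤∑ {suc n} c f c≤f = +-mono-≤ (c≤f Fin.zero) (n*c≤∑ c (λ i → f (Fin.suc i)) (λ i → c≤f (Fin.suc i)))

module _ {Bd Bb Bc : ℕ} (Bd≤Bb : Bd ≤ Bb) (Bb≤Bc : Bb ≤ Bc) where

  3≤weightedCount : ∀ x₁ x₂ x₃ x₄ →
    1 ≤ count≤ Bc (x₁ ∷ x₂ ∷ []) →
    1 ≤ count≤ Bb (x₁ ∷ x₂ ∷ x₃ ∷ []) →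
    1 ≤ count≤ Bd (x₁ ∷ x₂ ∷ x₃ ∷ x₄ ∷ []) →
    2 ≤ count≤ Bc (x₁ ∷ x₂ ∷ x₃ ∷ x₄ ∷ []) →
    3 ≤ count≤ Bc (x₁ ∷ x₂ ∷ x₃ ∷ x₄ ∷ []) + count≤ Bb (x₁ ∷ x₂ ∷ []) + count≤ Bd (x₃ ∷ [])
  3≤weightedCount x₁ x₂ x₃ x₄ c₂ b₃ d₄ c₄ with x₁ ≤? Bb | x₂ ≤? Bb
  ... | yes x₁≤Bb | _         = +-mono-≤ (+-mono-≤ c₄ (1≤count≤-∷ (x₂ ∷ []) x₁≤Bb)) z≤n
  ... | no _      | yes x₂≤Bb =
    +-mono-≤ (+-mono-≤ c₄ (≤-trans (1≤count≤-∷ [] x₂≤Bb) (m≤n+m (count≤ Bb (x₂ ∷ [])) 𝟙[ x₁ ≤ Bb ]))) z≤n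
  ... | no x₁≰Bb  | no x₂≰Bb with x₃ ≤? Bd
  ...   | yes x₃≤Bd = +-mono-≤ (+-mono-≤ c₄ z≤n) (1≤count≤-∷ [] x₃≤Bd)
  ...   | no x₃≰Bd  = +-mono-≤ (+-mono-≤ 3≤c₄ z≤n) z≤n
    -- Now x₃ ≤ Bb and x₄ ≤ Bd, so x₃, x₄ and one of x₁, x₂ are all ≤ Bc.
    where
    Bb<x₁ = ≰⇒> x₁≰Bb
    Bb<x₂ = ≰⇒> x₂≰Bb
    x₃≤Bb : x₃ ≤ Bb
    x₃≤Bb = 1≤count≤-[ x₃ ]⇒≤ (subst (1 ≤_)
      (trans (count≤-∷-> (x₂ ∷ x₃ ∷ []) Bb<x₁) (count≤-∷-> (x₃ ∷ []) Bb<x₂)) b₃)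
    x₄≤Bd : x₄ ≤ Bd
    x₄≤Bd = 1≤count≤-[ x₄ ]⇒≤ (subst (1 ≤_)
      (trans (count≤-∷-> (x₂ ∷ x₃ ∷ x₄ ∷ []) (≤-<-trans Bd≤Bb Bb<x₁))
        (trans (count≤-∷-> (x₃ ∷ x₄ ∷ []) (≤-<-trans Bd≤Bb Bb<x₂))
               (count≤-∷-> (x₄ ∷ []) (≰⇒> x₃≰Bd)))) d₄)
    x₃x₄≤Bc : count≤ Bc (x₃ ∷ x₄ ∷ []) ≡ 2
    x₃x₄≤Bc = trans (count≤-∷-≤ (x₄ ∷ []) (≤-trans x₃≤Bb Bb≤Bc))
                    (cong suc (count≤-∷-≤ [] (≤-trans x₄≤Bd (≤-trans Bd≤Bb Bb≤Bc))))
    3≤c₄ : 3 ≤ count≤ Bc (x₁ ∷ x₂ ∷ x₃ ∷ x₄ ∷ [])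
    3≤c₄ = subst (3 ≤_) (sym (count≤-++ Bc (x₁ ∷ x₂ ∷ []) (x₃ ∷ x₄ ∷ [])))
                 (+-mono-≤ c₂ (≤-reflexive (sym x₃x₄≤Bc)))

module _ {n : ℕ} (σ : Schedule n) where

  #days≤ : ℕ → List ℕ → Fin n → ℕ
  #days≤ b days i = count≤ b (map (λ s → item (σ s i)) days)

  ∑-#days≤ : ∀ b days → All (λ s → Bijective _≡_ _≡_ (σ s)) days →
    ∑[ i < n ] #days≤ b days i ≡ length days * (n ⊓ b)
  ∑-#days≤ b []         All.[]             = sum-replicate-zero n
  ∑-#days≤ b (s ∷ days) (σₛ-bij All.∷ bijs) = begin
    ∑[ i < n ] (𝟙[ item (σ s i) ≤ b ] + #days≤ b days i)
      ≡⟨ ∑-distrib-+ (λ i → 𝟙[ item (σ s i) ≤ b ]) (#days≤ b days) ⟩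
    ∑[ i < n ] 𝟙[ item (σ s i) ≤ b ] + ∑[ i < n ] #days≤ b days i
      ≡⟨ cong₂ _+_ (trans (∑-∘-bijective (λ x → 𝟙[ item x ≤ b ]) σₛ-bij) (∑-𝟙[item≤] n b))
                   (∑-#days≤ b days bijs) ⟩
    n ⊓ b + length days * (n ⊓ b) ∎
    where open ≡-Reasoning

  score : Fin n → ℕ
  score i = #days≤ (n / 2 + 1) (1 ∷ 2 ∷ 3 ∷ 4 ∷ []) i + #days≤ (n / 3 + 1) (1 ∷ 2 ∷ []) i
          + #days≤ (n / 4 + 1) (3 ∷ []) i

  weaklyBalanced⇒3≤score : ∀ i → (∀ t' → t' < 4 → WeaklyBalancedAt n σ t' i) → 3 ≤ score i
  weaklyBalanced⇒3≤score i balanced =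
    3≤weightedCount (+-monoˡ-≤ 1 (/-monoʳ-≤ n (from-yes (3 ≤? 4))))
                    (+-monoˡ-≤ 1 (/-monoʳ-≤ n (from-yes (2 ≤? 3))))
                    (item (σ 1 i)) (item (σ 2 i)) (item (σ 3 i)) (item (σ 4 i))
                    (minimum≤ 1 (from-yes (1 <? 4))) (minimum≤ 2 (from-yes (2 <? 4))) (minimum≤ 3 ≤-refl)
                    (subst (λ b → 2 ≤ count≤ (b + 1) (bundle σ i 4)) (m*n/m*o≡n/o 2 n 2)
                           (atLeast 3 1 (s≤s z≤n) ≤-refl))
    where
    atLeast : ∀ t' m → m ≤ t' → t' < 4 →
      suc m ≤ count≤ ((suc m * n) / suc t' + 1) (bundle σ i (suc t'))
    atLeast t' m m≤t' t'<4 = weaklyBalanced⇒count≤ (balanced t' t'<4) m≤t'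
    minimum≤ : ∀ t' → t' < 4 → 1 ≤ count≤ (n / suc t' + 1) (bundle σ i (suc t'))
    minimum≤ t' t'<4 = subst (λ m → 1 ≤ count≤ (m / suc t' + 1) (bundle σ i (suc t'))) (*-identityˡ n)
                             (atLeast t' 0 z≤n t'<4)

  ∑score≤ : (∀ s → 1 ≤ s → s ≤ 4 → Bijective _≡_ _≡_ (σ s)) →
    ∑[ i < n ] score i ≤ 4 * (n / 2 + 1) + 2 * (n / 3 + 1) + 1 * (n / 4 + 1)
  ∑score≤ bijective = begin
    ∑[ i < n ] score i
      ≡⟨ trans (∑-distrib-+ (λ i → #c i + #b i) #d) (cong (_+ ∑[ i < n ] #d i) (∑-distrib-+ #c #b)) ⟩
    ∑[ i < n ] #c i + ∑[ i < n ] #b i + ∑[ i < n ] #d i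
      ≡⟨ cong₂ _+_ (cong₂ _+_ (∑-#days≤ c _ (day 1 All.∷ day 2 All.∷ day 3 All.∷ day 4 All.∷ All.[]))
                              (∑-#days≤ b _ (day 1 All.∷ day 2 All.∷ All.[])))
                   (∑-#days≤ d _ (day 3 All.∷ All.[])) ⟩
    4 * (n ⊓ c) + 2 * (n ⊓ b) + 1 * (n ⊓ d)
      ≤⟨ +-mono-≤ (+-mono-≤ (*-monoʳ-≤ 4 (m⊓n≤n n c)) (*-monoʳ-≤ 2 (m⊓n≤n n b)))
                  (*-monoʳ-≤ 1 (m⊓n≤n n d)) ⟩
    4 * c + 2 * b + 1 * d ∎
    where
    open ≤-Reasoning
    c = n / 2 + 1
    b = n / 3 + 1
    d = n / 4 + 1
    #c = #days≤ c (1 ∷ 2 ∷ 3 ∷ 4 ∷ [])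
    #b = #days≤ b (1 ∷ 2 ∷ [])
    #d = #days≤ d (3 ∷ [])
    day : ∀ s → {True (1 ≤? s)} → {True (s ≤? 4)} → Bijective _≡_ _≡_ (σ s)
    day s {1≤s} {s≤4} = bijective s (toWitness 1≤s) (toWitness s≤4)

m≡n*o⇒m/o≡n : ∀ {m} n o .{{_ : NonZero o}} → m ≡ n * o → m / o ≡ n
m≡n*o⇒m/o≡n n o refl = m*n/n≡m n o

linear-counting-bound⇒k≤14 : ∀ k q → q * 4 ≤ 6 * k →
  6 * k * 3 ≤ 4 * (3 * k + 1) + 2 * (2 * k + 1) + 1 * (q + 1) → k ≤ 14
linear-counting-bound⇒k≤14 k q q*4≤6k bound = *-cancelˡ-≤ 2 (+-cancelʳ-≤ (70 * k) (2 * k) 28 (begin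
  2 * k + 70 * k                                        ≡⟨ solve (k ∷ []) ⟩
  4 * (6 * k * 3)                                       ≤⟨ *-monoʳ-≤ 4 bound ⟩
  4 * (4 * (3 * k + 1) + 2 * (2 * k + 1) + 1 * (q + 1)) ≡⟨ solve (k ∷ q ∷ []) ⟩
  28 + 64 * k + q * 4                                   ≤⟨ +-monoʳ-≤ (28 + 64 * k) q*4≤6k ⟩
  28 + 64 * k + 6 * k                                   ≡⟨ solve (k ∷ []) ⟩
  28 + 70 * k                                           ∎))
  where open ≤-Reasoning

counting-bound⇒k≤14 : ∀ k → let n = 6 * k in
  n * 3 ≤ 4 * (n / 2 + 1) + 2 * (n / 3 + 1) + 1 * (n / 4 + 1) → k ≤ 14
counting-bound⇒k≤14 k bound =
  linear-counting-bound⇒k≤14 k (6 * k / 4) (m/n*n≤m (6 * k) 4)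
    (subst₂ (λ a b → 6 * k * 3 ≤ 4 * (a + 1) + 2 * (b + 1) + 1 * (6 * k / 4 + 1)) n/2≡3k n/3≡2k bound)
  where
  n/2≡3k : 6 * k / 2 ≡ 3 * k
  n/2≡3k = m≡n*o⇒m/o≡n {6 * k} (3 * k) 2 (solve (k ∷ []))
  n/3≡2k : 6 * k / 3 ≡ 2 * k
  n/3≡2k = m≡n*o⇒m/o≡n {6 * k} (2 * k) 3 (solve (k ∷ []))

proposition6 : (k : ℕ) → 19 ≤ k →
    ¬ (Σ (Schedule (6 * k)) λ σ →
         AllBijections (6 * k) σ ×
         ((t' : ℕ) → suc t' ≤ 6 * k → (i : Fin (6 * k)) →
          WeaklyBalancedAt (6 * k) σ t' i))
proposition6 k 19≤k (σ , bijective , balanced) =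
  <⇒≱ (≤-trans (from-yes (15 ≤? 19)) 19≤k) (counting-bound⇒k≤14 k (begin
    n * 3                                               ≤⟨ n*c≤∑ 3 (score σ) 3≤score ⟩
    ∑[ i < n ] score σ i                                ≤⟨ ∑score≤ σ bijectiveEarly ⟩
    4 * (n / 2 + 1) + 2 * (n / 3 + 1) + 1 * (n / 4 + 1) ∎))
  where
  open ≤-Reasoning
  n = 6 * k
  4≤n : 4 ≤ n
  4≤n = ≤-trans (from-yes (4 ≤? 6 * 19)) (*-monoʳ-≤ 6 19≤k)
  bijectiveEarly : ∀ s → 1 ≤ s → s ≤ 4 → Bijective _≡_ _≡_ (σ s)
  bijectiveEarly s 1≤s s≤4 = bijective s 1≤s (≤-trans s≤4 4≤n)
  3≤score : ∀ i → 3 ≤ score σ i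
  3≤score i = weaklyBalanced⇒3≤score σ i (λ t' t'<4 → balanced t' (≤-trans t'<4 4≤n) i)
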